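{- Let $n\ge 2$ and let $v(\Omega_n)$ denote the number of vertices (extreme points) of the polytope $\Omega_n\subset\mathbb{R}^{n^3}$ of all $n\times n\times n$ stochastic tensors. Then $$v(\Omega_n)\le \frac{1}{n^3}\binom{p(n)}{n^3-1},\qquad\text{where } p(n)=n^3+6n^2-6n+2 .$$
   Context: An $n\times n\times n$ tensor $A=(a_{ijk})$ is stochastic if all $a_{ijk}\ge 0$ and $\sum_{i=1}^n a_{ijk}=1$ for all $j,k$, $\sum_{j=1}^n a_{ijk}=1$ for all $i,k$, and $\sum_{k=1}^n a_{ijk}=1$ for all $i,j$; such tensors are regarded as points of $\mathbb{R}^{n^3}$, and $\Omega_n$ is the (compact convex) polytope they form.
   Formalization: The stochastic tensors, both the vertices counted and the points combined to test extremality, have rational entries rather than real ones. -}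

module Defs where

open import Data.Nat using (ℕ; zero; suc; _∸_; _^_) renaming (_+_ to _+ℕ_; _*_ to _*ℕ_)
open import Data.Fin using (Fin; zero; suc)
open import Data.Product using (_×_; ∃)
open import Data.Rational using (ℚ; 0ℚ; 1ℚ; _+_; _*_; _-_; _≤_; _<_)
open import Relation.Binary.PropositionalEquality using (_≡_)
open import Relation.Nullary using (¬_)

Tensor : ℕ → Set
Tensor n = Fin n → Fin n → Fin n → ℚ

sumFin : ∀ {n} → (Fin n → ℚ) → ℚ
sumFin {zero}  f = 0ℚ
sumFin {suc n} f = f zero + sumFin (λ i → f (suc i))

Stochastic : ∀ {n} → Tensor n → Set
Stochastic {n} A =
  (∀ i j k → 0ℚ ≤ A i j k) ×
  (∀ j k → sumFin (λ i → A i j k) ≡ 1ℚ) ×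
  (∀ i k → sumFin (λ j → A i j k) ≡ 1ℚ) ×
  (∀ i j → sumFin (λ k → A i j k) ≡ 1ℚ)

_≋_ : ∀ {n} → Tensor n → Tensor n → Set
A ≋ B = ∀ i j k → A i j k ≡ B i j k

IsVertex : ∀ {n} → Tensor n → Set
IsVertex {n} A =
  Stochastic A ×
  (∀ (B C : Tensor n) (t : ℚ) → 0ℚ < t → t < 1ℚ →
     Stochastic B → Stochastic C →
     (∀ i j k → A i j k ≡ t * B i j k + (1ℚ - t) * C i j k) →
     (B ≋ A) × (C ≋ A))

Distinct : ∀ {n} → Tensor n → Tensor n → Set
Distinct A B = ¬ (A ≋ B)

-- p(n) = n^3 + 6n^2 - 6n + 2 (nonnegative since 6n^2 ≥ 6n).
p : ℕ → ℕ
p n = (n ^ 3 +ℕ 6 *ℕ n ^ 2 +ℕ 2) ∸ 6 *ℕ n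

-- A vertex A of Ω_n is rigid: a tensor D with zero line sums that vanishes wherever A does is
-- zero, for otherwise A ± εD lie in Ω_n for small ε > 0 and A is their midpoint. The (n-1)³
-- tensors (e_a − e_n) ⊗ (e_b − e_n) ⊗ (e_c − e_n) have zero line sums and are linearly
-- independent, so A has at least (n-1)³ zero entries, i.e. at most m = n³ − (n-1)³ nonzero
-- ones; rigidity applied to A − B shows moreover that a vertex is determined by its zero set.
-- So the vertices inject into the sets of at most m of the n³ cells, which number at most
-- C(n³ + m, m), and n³ · C(n³ + m, m) ≤ C(n³ + 2m, n³ − 1) = C(p(n), n³ − 1).

module Submission where

open import Defs

module Binomial where

  open import Data.Nat
  open import Data.Nat.Properties
  open import Data.Nat.Combinatorics using (_C_; nCk+nC[k+1]≡[n+1]C[k+1]; nCk≡nC[n∸k]; nC1≡n)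
  open import Data.Nat.Tactic.RingSolver using (solve-∀)
  open import Relation.Binary.PropositionalEquality
  open import Relation.Nullary.Decidable using (toWitness)

  [n+1]C[k+1]≡nCk+nC[k+1] : ∀ n k → suc n C suc k ≡ n C k + n C suc k
  [n+1]C[k+1]≡nCk+nC[k+1] n k = sym (nCk+nC[k+1]≡[n+1]C[k+1] n k)

  nCk≤[n+1]Ck : ∀ n k → n C k ≤ suc n C k
  nCk≤[n+1]Ck n zero    = ≤-refl
  nCk≤[n+1]Ck n (suc k) = subst (n C suc k ≤_) (sym ([n+1]C[k+1]≡nCk+nC[k+1] n k)) (m≤n+m (n C suc k) (n C k))

  [k+1]*[n+1]C[k+1]≡[n+1]*nCk : ∀ n k → suc k * (suc n C suc k) ≡ suc n * (n C k)
  [k+1]*[n+1]C[k+1]≡[n+1]*nCk zero    zero    = refl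
  [k+1]*[n+1]C[k+1]≡[n+1]*nCk zero    (suc k) = *-zeroʳ (suc (suc k))
  [k+1]*[n+1]C[k+1]≡[n+1]*nCk (suc n) zero    =
    trans (+-identityʳ _) (trans (nC1≡n (suc (suc n))) (sym (*-identityʳ (suc (suc n)))))
  [k+1]*[n+1]C[k+1]≡[n+1]*nCk (suc n) (suc k) = begin
      suc (suc k) * (suc (suc n) C suc (suc k))   ≡⟨ cong (suc (suc k) *_) ([n+1]C[k+1]≡nCk+nC[k+1] (suc n) (suc k)) ⟩
      suc (suc k) * (X + Y)                       ≡⟨ *-distribˡ-+ (suc (suc k)) X Y ⟩
      (X + suc k * X) + suc (suc k) * Y           ≡⟨ cong₂ (λ u v → (X + u) + v) ([k+1]*[n+1]C[k+1]≡[n+1]*nCk n k)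
                                                                                ([k+1]*[n+1]C[k+1]≡[n+1]*nCk n (suc k)) ⟩
      (X + suc n * (n C k)) + suc n * (n C suc k) ≡⟨ +-assoc X _ _ ⟩
      X + (suc n * (n C k) + suc n * (n C suc k)) ≡⟨ cong (X +_) (*-distribˡ-+ (suc n) (n C k) (n C suc k)) ⟨
      X + suc n * (n C k + n C suc k)             ≡⟨ cong (λ c → X + suc n * c) ([n+1]C[k+1]≡nCk+nC[k+1] n k) ⟨
      X + suc n * X                               ∎
    where
    open ≡-Reasoning
    X = suc n C suc k
    Y = suc n C suc (suc k)

  [k+1]*[n+k]C[k+1]≡n*[n+k]Ck : ∀ n k → suc k * ((n + k) C suc k) ≡ n * ((n + k) C k)
  [k+1]*[n+k]C[k+1]≡n*[n+k]Ck n k = +-cancelˡ-≡ (suc k * B) _ _ (begin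
      suc k * B + suc k * B′        ≡⟨ *-distribˡ-+ (suc k) B B′ ⟨
      suc k * (B + B′)              ≡⟨ cong (suc k *_) ([n+1]C[k+1]≡nCk+nC[k+1] (n + k) k) ⟨
      suc k * (suc (n + k) C suc k) ≡⟨ [k+1]*[n+1]C[k+1]≡[n+1]*nCk (n + k) k ⟩
      suc (n + k) * B               ≡⟨ split n k B ⟩
      suc k * B + n * B             ∎)
    where
    open ≡-Reasoning
    B  = (n + k) C k
    B′ = (n + k) C suc k
    split : ∀ n k b → (1 + (n + k)) * b ≡ (1 + k) * b + n * b
    split = solve-∀

  2*nCk≤[n+1]C[k+1] : ∀ {n k} → 2 * suc k ≤ suc n → 2 * (n C k) ≤ suc n C suc k
  2*nCk≤[n+1]C[k+1] {n} {k} 2[k+1]≤n+1 = *-cancelˡ-≤ (suc k) (begin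
      suc k * (2 * (n C k))   ≡⟨ *-assoc (suc k) 2 (n C k) ⟨
      suc k * 2 * (n C k)     ≡⟨ cong (_* (n C k)) (*-comm (suc k) 2) ⟩
      2 * suc k * (n C k)     ≤⟨ *-monoˡ-≤ (n C k) 2[k+1]≤n+1 ⟩
      suc n * (n C k)         ≡⟨ [k+1]*[n+1]C[k+1]≡[n+1]*nCk n k ⟨
      suc k * (suc n C suc k) ∎)
    where open ≤-Reasoning

  2^j*nCk≤[n+j]C[k+j] : ∀ j {n k} → 2 * (k + j) ≤ n + j → 2 ^ j * (n C k) ≤ (n + j) C (k + j)
  2^j*nCk≤[n+j]C[k+j] zero {n} {k} _ rewrite +-identityʳ n | +-identityʳ k = ≤-reflexive (+-identityʳ (n C k))
  2^j*nCk≤[n+j]C[k+j] (suc j) {n} {k} 2[k+1+j]≤n+1+j = begin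
      2 ^ suc j * (n C k)       ≡⟨ *-assoc 2 (2 ^ j) (n C k) ⟩
      2 * (2 ^ j * (n C k))     ≤⟨ *-monoʳ-≤ 2 (2^j*nCk≤[n+j]C[k+j] j {n} {k} (<⇒≤ (≤-pred 2+2[k+j]≤1+n+j))) ⟩
      2 * ((n + j) C (k + j))   ≤⟨ 2*nCk≤[n+1]C[k+1] (subst (_≤ suc (n + j)) (sym (*-suc 2 (k + j))) 2+2[k+j]≤1+n+j) ⟩
      suc (n + j) C suc (k + j) ≡⟨ cong₂ _C_ (+-suc n j) (+-suc k j) ⟨
      (n + suc j) C (k + suc j) ∎
    where
    open ≤-Reasoning
    2+2[k+j]≤1+n+j : 2 + 2 * (k + j) ≤ suc (n + j)
    2+2[k+j]≤1+n+j = subst₂ _≤_ (trans (cong (2 *_) (+-suc k j)) (*-suc 2 (k + j))) (+-suc n j) 2[k+1+j]≤n+1+j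

  1+n≤2^n : ∀ n → suc n ≤ 2 ^ n
  1+n≤2^n zero    = ≤-refl
  1+n≤2^n (suc n) = +-mono-≤ (m^n>0 2 n) (≤-trans (1+n≤2^n n) (m≤m+n (2 ^ n) 0))

  [m+n]Cn≡[m+n]Cm : ∀ m n → (m + n) C n ≡ (m + n) C m
  [m+n]Cn≡[m+n]Cm m n = trans (nCk≡nC[n∸k] (m≤n+m n m)) (cong ((m + n) C_) (m+n∸n≡m m n))

  [1+N]*[1+N+m]Cm≤[1+N+2m]CN : ∀ N m → 2 * m + 2 ≤ suc N → suc N * ((suc N + m) C m) ≤ (suc N + m + m) C N
  [1+N]*[1+N+m]Cm≤[1+N+2m]CN N m 2m+2≤1+N = begin
      suc N * ((suc N + m) C m)          ≡⟨ [k+1]*[n+k]C[k+1]≡n*[n+k]Ck (suc N) m ⟨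
      suc m * ((suc N + m) C suc m)      ≤⟨ *-monoˡ-≤ _ (1+n≤2^n m) ⟩
      2 ^ m * ((suc N + m) C suc m)      ≤⟨ 2^j*nCk≤[n+j]C[k+j] m {suc N + m} {suc m} doubling-room ⟩
      (suc N + m + m) C (suc m + m)      ≡⟨ cong (_C (suc m + m)) (regroup N m) ⟩
      (N + (suc m + m)) C (suc m + m)    ≡⟨ [m+n]Cn≡[m+n]Cm N (suc m + m) ⟩
      (N + (suc m + m)) C N              ≡⟨ cong (_C N) (regroup N m) ⟨
      (suc N + m + m) C N                ∎
    where
    open ≤-Reasoning
    regroup : ∀ N m → (1 + N) + m + m ≡ N + ((1 + m) + m)
    regroup = solve-∀
    doubling-room : 2 * (suc m + m) ≤ suc N + m + m
    doubling-room = subst₂ _≤_ (lhs m) (rhs (suc N) m) (+-monoˡ-≤ (2 * m) 2m+2≤1+N)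
      where
      lhs : ∀ m → 2 * m + 2 + 2 * m ≡ 2 * ((1 + m) + m)
      lhs = solve-∀
      rhs : ∀ N m → N + 2 * m ≡ N + m + m
      rhs = solve-∀

  -- (k + 1)³ − k³
  maxSupport : ℕ → ℕ
  maxSupport k = 3 * (k * k) + 3 * k + 1

  p[1+k]≡[1+k]³+2*maxSupport : ∀ k → p (suc k) ≡ suc k ^ 3 + maxSupport k + maxSupport k
  p[1+k]≡[1+k]³+2*maxSupport k =
    trans (cong (_∸ 6 * suc k) (expand k)) (m+n∸n≡m (suc k ^ 3 + maxSupport k + maxSupport k) (6 * suc k))
    where
    expand : ∀ k → let n = 1 + k in
      n * (n * (n * 1)) + 6 * (n * (n * 1)) + 2
        ≡ n * (n * (n * 1)) + (3 * (k * k) + 3 * k + 1) + (3 * (k * k) + 3 * k + 1) + 6 * n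
    expand = solve-∀

  2*maxSupport+2≤[5+t]³ : ∀ t → 2 * maxSupport (4 + t) + 2 ≤ (5 + t) ^ 3
  2*maxSupport+2≤[5+t]³ t = subst (2 * maxSupport (4 + t) + 2 ≤_) (sym (expand t)) (m≤m+n _ _)
    where
    expand : ∀ t → (5 + t) * ((5 + t) * ((5 + t) * 1))
                     ≡ (2 * (3 * ((4 + t) * (4 + t)) + 3 * (4 + t) + 1) + 2) + (t * t * t + 9 * (t * t) + 21 * t + 1)
    expand = solve-∀

  -- The hypothesis 2 * maxSupport k + 2 ≤ (k + 1)³ of the general estimate fails for k ≤ 3;
  -- those three cases are decided by evaluation.
  binomial-estimate : ∀ k → 1 ≤ k →
    suc k ^ 3 * ((suc k ^ 3 + maxSupport k) C maxSupport k) ≤ p (suc k) C (suc k ^ 3 ∸ 1)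
  binomial-estimate 1 _ = toWitness {a? = _ ≤? _} _
  binomial-estimate 2 _ = toWitness {a? = _ ≤? _} _
  binomial-estimate 3 _ = toWitness {a? = _ ≤? _} _
  binomial-estimate k@(suc (suc (suc (suc t)))) _ = begin
      N * ((N + m) C m)         ≤⟨ [1+N]*[1+N+m]Cm≤[1+N+2m]CN (N ∸ 1) m (2*maxSupport+2≤[5+t]³ t) ⟩
      (N + m + m) C (N ∸ 1)     ≡⟨ cong (_C (N ∸ 1)) (p[1+k]≡[1+k]³+2*maxSupport k) ⟨
      p (suc k) C (N ∸ 1)       ∎
    where
    open ≤-Reasoning
    N = suc k ^ 3
    m = maxSupport k

module Counting where

  open import Data.Bool using (Bool; true; false)
  open import Data.Empty using (⊥-elim)
  open import Data.Fin using (Fin; zero; suc)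
  open import Data.Fin.Properties using (injective⇒≤)
  open import Data.List using (List; []; _∷_; [_]; _++_; map; length; lookup; filter)
  open import Data.List.Properties using (length-++; length-map; ∷-injectiveˡ; ∷-injectiveʳ)
  open import Data.List.Membership.Propositional using (_∈_)
  open import Data.List.Membership.Propositional.Properties using (∈-lookup; ∈-++⁺ˡ; ∈-++⁺ʳ; ∈-map⁺)
  open import Data.List.Relation.Binary.Subset.Propositional using (_⊆_)
  open import Data.List.Relation.Unary.All as All using ()
  open import Data.List.Relation.Unary.AllPairs using (_∷_)
  open import Data.List.Relation.Unary.Any using (here; there; index)
  open import Data.List.Relation.Unary.Any.Properties using (lookup-index)
  open import Data.List.Relation.Unary.Unique.Propositional using (Unique)
  open import Data.Nat
  open import Data.Nat.Properties
  open import Data.Nat.Combinatorics using (_C_; nCn≡1)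
  open import Function using (_∘_)
  open import Relation.Binary.PropositionalEquality hiding ([_])
  open import Relation.Nullary using (does)
  open import Relation.Unary using (Decidable)
  open Binomial using ([n+1]C[k+1]≡nCk+nC[k+1]; nCk≤[n+1]Ck)

  lookup-injective : ∀ {A : Set} {xs : List A} → Unique xs → ∀ {i j} → lookup xs i ≡ lookup xs j → i ≡ j
  lookup-injective {xs = _ ∷ _} _         {zero}  {zero}  _  = refl
  lookup-injective {xs = _ ∷ _} (x∉ ∷ _)  {zero}  {suc j} eq = ⊥-elim (All.lookup x∉ (∈-lookup j) eq)
  lookup-injective {xs = _ ∷ _} (x∉ ∷ _)  {suc i} {zero}  eq = ⊥-elim (All.lookup x∉ (∈-lookup i) (sym eq))
  lookup-injective {xs = _ ∷ _} (_ ∷ xs!) {suc i} {suc j} eq = cong suc (lookup-injective xs! eq)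

  Unique∧⊆⇒length≤ : ∀ {A : Set} {xs ys : List A} → Unique xs → xs ⊆ ys → length xs ≤ length ys
  Unique∧⊆⇒length≤ {xs = xs} {ys} xs! xs⊆ys = injective⇒≤ position-injective
    where
    position : Fin (length xs) → Fin (length ys)
    position i = index (xs⊆ys (∈-lookup i))
    position-injective : ∀ {i j} → position i ≡ position j → i ≡ j
    position-injective {i} {j} eq = lookup-injective xs! (begin
      lookup xs i           ≡⟨ lookup-index (xs⊆ys (∈-lookup i)) ⟩
      lookup ys (position i) ≡⟨ cong (lookup ys) eq ⟩
      lookup ys (position j) ≡⟨ lookup-index (xs⊆ys (∈-lookup j)) ⟨
      lookup xs j           ∎)
      where open ≡-Reasoning

  falses : List Bool → ℕ
  falses []           = 0
  falses (true ∷ bs)  = falses bs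
  falses (false ∷ bs) = suc (falses bs)

  sparse : ℕ → ℕ → List (List Bool)
  sparse zero    m       = [ [] ]
  sparse (suc N) zero    = map (true ∷_) (sparse N zero)
  sparse (suc N) (suc m) = map (false ∷_) (sparse N m) ++ map (true ∷_) (sparse N (suc m))

  ∈-sparse : ∀ {m} bs → falses bs ≤ m → bs ∈ sparse (length bs) m
  ∈-sparse         []           _         = here refl
  ∈-sparse {zero}  (true ∷ bs)  f≤m       = ∈-map⁺ (true ∷_) (∈-sparse bs f≤m)
  ∈-sparse {suc m} (true ∷ bs)  f≤m       = ∈-++⁺ʳ _ (∈-map⁺ (true ∷_) (∈-sparse bs f≤m))
  ∈-sparse {suc m} (false ∷ bs) (s≤s f≤m) = ∈-++⁺ˡ (∈-map⁺ (false ∷_) (∈-sparse bs f≤m))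

  length-sparse : ∀ N m → length (sparse N m) ≤ (N + m) C m
  length-sparse zero    m       = ≤-reflexive (sym (nCn≡1 m))
  length-sparse (suc N) zero    = ≤-trans (≤-reflexive (length-map _ (sparse N zero))) (length-sparse N zero)
  length-sparse (suc N) (suc m) = begin
      length (map (false ∷_) (sparse N m) ++ map (true ∷_) (sparse N (suc m)))
        ≡⟨ length-++ (map (false ∷_) (sparse N m)) ⟩
      length (map (false ∷_) (sparse N m)) + length (map (true ∷_) (sparse N (suc m)))
        ≡⟨ cong₂ _+_ (length-map _ (sparse N m)) (length-map _ (sparse N (suc m))) ⟩
      length (sparse N m) + length (sparse N (suc m))
        ≤⟨ +-mono-≤ (length-sparse N m) (length-sparse N (suc m)) ⟩
      (N + m) C m + (N + suc m) C suc m
        ≤⟨ +-monoˡ-≤ _ (subst (λ t → (N + m) C m ≤ t C m) (sym (+-suc N m)) (nCk≤[n+1]Ck (N + m) m)) ⟩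
      (N + suc m) C m + (N + suc m) C suc m
        ≡⟨ [n+1]C[k+1]≡nCk+nC[k+1] (N + suc m) m ⟨
      (suc N + suc m) C suc m ∎
    where open ≤-Reasoning

  falses-map-does+length-filter : ∀ {A : Set} {P : A → Set} (P? : Decidable P) xs →
    falses (map (does ∘ P?) xs) + length (filter P? xs) ≡ length xs
  falses-map-does+length-filter P? []       = refl
  falses-map-does+length-filter P? (x ∷ xs) with does (P? x)
  ... | true  = trans (+-suc _ _) (cong suc (falses-map-does+length-filter P? xs))
  ... | false = cong suc (falses-map-does+length-filter P? xs)

  map-≡⇒∈-≗ : ∀ {A B : Set} {f g : A → B} {xs} → map f xs ≡ map g xs → ∀ {x} → x ∈ xs → f x ≡ g x
  map-≡⇒∈-≗ {xs = _ ∷ _} eq (here refl)  = ∷-injectiveˡ eq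
  map-≡⇒∈-≗ {xs = _ ∷ _} eq (there x∈xs) = map-≡⇒∈-≗ (∷-injectiveʳ eq) x∈xs

module LinearAlgebra where

  open import Algebra.Bundles using (CommutativeRing)
  open import Data.Fin as F using (Fin; zero; suc; punchIn)
  open import Data.Fin.Properties using (punchInᵢ≢i)
  open import Data.List using (List; length; map)
  open import Data.List.Properties using (length-map; length-removeAt′)
  open import Data.List.Relation.Unary.All as All using (All; all?)
  open import Data.List.Relation.Unary.All.Properties using (¬All⇒Any¬; ─⁻; map⁻)
  open import Data.List.Relation.Unary.Any as Any using (Any)
  open import Data.List.Relation.Unary.Any.Properties using (lookup-result)
  import Data.Nat as ℕ
  open import Data.Product using (∃-syntax; _×_; _,_)
  open import Data.Rational
  open import Data.Rational.Properties
  open import Data.Rational.Solver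
  open import Data.Vec.Functional using (tail)
  open import Function using (_∘_)
  open import Relation.Binary.PropositionalEquality
  open import Relation.Nullary using (yes; no; contradiction)
  open import Algebra.Properties.Semiring.Sum (CommutativeRing.semiring +-*-commutativeRing)
    using (sum; sum-cong-≗; sum-replicate-zero; sum-remove; ∑-distrib-+; ∑-comm; *-distribˡ-sum; *-distribʳ-sum)
  open +-*-Solver

  sumFin≡sum : ∀ {n} (f : Fin n → ℚ) → sumFin f ≡ sum f
  sumFin≡sum {ℕ.zero}  f = refl
  sumFin≡sum {ℕ.suc n} f = cong (f zero +_) (sumFin≡sum (tail f))

  sumFin-cong : ∀ {n} {f g : Fin n → ℚ} → (∀ i → f i ≡ g i) → sumFin f ≡ sumFin g
  sumFin-cong {f = f} {g} f≗g = trans (sumFin≡sum f) (trans (sum-cong-≗ f≗g) (sym (sumFin≡sum g)))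

  sumFin-zero : ∀ n → sumFin {n} (λ _ → 0ℚ) ≡ 0ℚ
  sumFin-zero n = trans (sumFin≡sum {n} (λ _ → 0ℚ)) (sum-replicate-zero n)

  sumFin-+ : ∀ {n} (f g : Fin n → ℚ) → sumFin (λ i → f i + g i) ≡ sumFin f + sumFin g
  sumFin-+ f g = trans (sumFin≡sum (λ i → f i + g i))
    (trans (∑-distrib-+ f g) (sym (cong₂ _+_ (sumFin≡sum f) (sumFin≡sum g))))

  sumFin-*ˡ : ∀ {n} c (f : Fin n → ℚ) → sumFin (λ i → c * f i) ≡ c * sumFin f
  sumFin-*ˡ c f = trans (sumFin≡sum (λ i → c * f i)) (sym (trans (cong (c *_) (sumFin≡sum f)) (*-distribˡ-sum c f)))

  sumFin-*ʳ : ∀ {n} c (f : Fin n → ℚ) → sumFin (λ i → f i * c) ≡ sumFin f * c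
  sumFin-*ʳ c f = trans (sumFin≡sum (λ i → f i * c)) (sym (trans (cong (_* c) (sumFin≡sum f)) (*-distribʳ-sum c f)))

  sumFin-comm : ∀ {m n} (f : Fin m → Fin n → ℚ) →
    sumFin (λ i → sumFin (λ j → f i j)) ≡ sumFin (λ j → sumFin (λ i → f i j))
  sumFin-comm f = begin
    sumFin (λ i → sumFin (f i))        ≡⟨ sumFin-cong (λ i → sumFin≡sum (f i)) ⟩
    sumFin (λ i → sum (f i))           ≡⟨ sumFin≡sum (λ i → sum (f i)) ⟩
    sum (λ i → sum (f i))              ≡⟨ ∑-comm f ⟩
    sum (λ j → sum (λ i → f i j))      ≡⟨ sumFin≡sum (λ j → sum (λ i → f i j)) ⟨
    sumFin (λ j → sum (λ i → f i j))   ≡⟨ sumFin-cong (λ j → sumFin≡sum (λ i → f i j)) ⟨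
    sumFin (λ j → sumFin (λ i → f i j)) ∎
    where open ≡-Reasoning

  sumFin-single : ∀ {n} (f : Fin n → ℚ) b → (∀ i → i ≢ b → f i ≡ 0ℚ) → sumFin f ≡ f b
  sumFin-single {ℕ.suc n} f b f≡0 = begin
    sumFin f                                  ≡⟨ sumFin≡sum f ⟩
    sum f                                     ≡⟨ sum-remove {i = b} f ⟩
    f b + sum (λ i → f (punchIn b i))         ≡⟨ cong (f b +_) (sum-cong-≗ (λ i → f≡0 (punchIn b i) (punchInᵢ≢i b i))) ⟩
    f b + sum {n} (λ _ → 0ℚ)                 ≡⟨ cong (f b +_) (sum-replicate-zero n) ⟩
    f b + 0ℚ                                  ≡⟨ +-identityʳ (f b) ⟩
    f b                                       ∎
    where open ≡-Reasoning

  -p≡-1*p : ∀ p → - p ≡ - 1ℚ * p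
  -p≡-1*p p = trans (cong -_ (sym (*-identityˡ p))) (neg-distribˡ-* 1ℚ p)

  sumFin-neg : ∀ {n} (f : Fin n → ℚ) → sumFin (λ i → - f i) ≡ - sumFin f
  sumFin-neg f = trans (sumFin-cong (λ i → -p≡-1*p (f i))) (trans (sumFin-*ˡ (- 1ℚ) f) (sym (-p≡-1*p (sumFin f))))

  sumFin-− : ∀ {n} (f g : Fin n → ℚ) → sumFin (λ i → f i - g i) ≡ sumFin f - sumFin g
  sumFin-− f g = trans (sumFin-+ f (λ i → - g i)) (cong (sumFin f +_) (sumFin-neg g))

  unit : ∀ {n} → Fin n → Fin n → ℚ
  unit b i with b F.≟ i
  ... | yes _ = 1ℚ
  ... | no  _ = 0ℚ

  unit-same : ∀ {n} (b : Fin n) → unit b b ≡ 1ℚ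
  unit-same b with b F.≟ b
  ... | yes _   = refl
  ... | no  b≢b = contradiction refl b≢b

  unit-≢ : ∀ {n} {b i : Fin n} → b ≢ i → unit b i ≡ 0ℚ
  unit-≢ {b = b} {i} b≢i with b F.≟ i
  ... | yes b≡i = contradiction b≡i b≢i
  ... | no  _   = refl

  sumFin-unit : ∀ {n} (b : Fin n) → sumFin (unit b) ≡ 1ℚ
  sumFin-unit b = trans (sumFin-single (unit b) b (λ i i≢b → unit-≢ (i≢b ∘ sym))) (unit-same b)

  dot : ∀ {n} → (Fin n → ℚ) → (Fin n → ℚ) → ℚ
  dot e x = sumFin (λ i → e i * x i)

  dot-unit : ∀ {n} (e : Fin n → ℚ) b → dot e (unit b) ≡ e b
  dot-unit e b = begin
    dot e (unit b)     ≡⟨ sumFin-single _ b (λ i i≢b → trans (cong (e i *_) (unit-≢ (i≢b ∘ sym))) (*-zeroʳ (e i))) ⟩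
    e b * unit b b     ≡⟨ cong (e b *_) (unit-same b) ⟩
    e b * 1ℚ           ≡⟨ *-identityʳ (e b) ⟩
    e b                ∎
    where open ≡-Reasoning

  dot-−* : ∀ {n} (f g y : Fin n → ℚ) c → dot (λ i → f i - c * g i) y ≡ dot f y - c * dot g y
  dot-−* f g y c = begin
    dot (λ i → f i - c * g i) y                                ≡⟨ sumFin-cong (λ i → distrib (f i) (g i) (y i) c) ⟩
    sumFin (λ i → f i * y i - c * (g i * y i))                 ≡⟨ sumFin-− (λ i → f i * y i) (λ i → c * (g i * y i)) ⟩
    dot f y - sumFin (λ i → c * (g i * y i))                   ≡⟨ cong (λ t → dot f y - t) (sumFin-*ˡ c (λ i → g i * y i)) ⟩
    dot f y - c * dot g y                                      ∎
    where
    open ≡-Reasoning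
    distrib : ∀ a b x c → (a - c * b) * x ≡ a * x - c * (b * x)
    distrib = solve 4 (λ a b x c → (a :- c :* b) :* x := a :* x :- c :* (b :* x)) refl

  sumFin-scaled-zero : ∀ {n} {f g : Fin n → ℚ} c → sumFin f ≡ 0ℚ → (∀ i → g i ≡ c * f i) → sumFin g ≡ 0ℚ
  sumFin-scaled-zero {f = f} c f≡0 g≡cf =
    trans (sumFin-cong g≡cf) (trans (sumFin-*ˡ c f) (trans (cong (c *_) f≡0) (*-zeroʳ c)))

  sumFin-dot-zero : ∀ {m n} (F : Fin m → Fin n → ℚ) (x : Fin m → ℚ) → (∀ b → sumFin (F b) ≡ 0ℚ) →
    sumFin (λ i → dot (λ b → F b i) x) ≡ 0ℚ
  sumFin-dot-zero {m} F x F≡0 = begin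
    sumFin (λ i → sumFin (λ b → F b i * x b)) ≡⟨ sumFin-comm (λ i b → F b i * x b) ⟩
    sumFin (λ b → sumFin (λ i → F b i * x b)) ≡⟨ sumFin-cong (λ b → trans (sumFin-*ʳ (x b) (F b)) Fb*xb≡0) ⟩
    sumFin {m} (λ _ → 0ℚ)                    ≡⟨ sumFin-zero m ⟩
    0ℚ                                        ∎
    where
    open ≡-Reasoning
    Fb*xb≡0 : ∀ {b} → sumFin (F b) * x b ≡ 0ℚ
    Fb*xb≡0 {b} = trans (cong (_* x b) (F≡0 b)) (*-zeroˡ (x b))

  module Pivot {u} (e : Fin (ℕ.suc u) → ℚ) (e₀≢0 : e zero ≢ 0ℚ) where

    private instance
      e₀-nonZero : NonZero (e zero)
      e₀-nonZero = ≢-nonZero e₀≢0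

    eliminate : (Fin (ℕ.suc u) → ℚ) → Fin u → ℚ
    eliminate f i = f (suc i) - (f zero * 1/ e zero) * e (suc i)

    extend : (Fin u → ℚ) → Fin (ℕ.suc u) → ℚ
    extend y zero    = - dot (tail e) y * 1/ e zero
    extend y (suc i) = y i

    dot-extend : ∀ f y → dot f (extend y) ≡ dot (eliminate f) y
    dot-extend f y = begin
      f zero * (- S * 1/ e zero) + T   ≡⟨ rearrange (f zero) S (1/ e zero) T ⟩
      T - (f zero * 1/ e zero) * S     ≡⟨ dot-−* (tail f) (tail e) y (f zero * 1/ e zero) ⟨
      dot (eliminate f) y              ∎
      where
      open ≡-Reasoning
      S = dot (tail e) y
      T = dot (tail f) y
      rearrange : ∀ a s i t → a * (- s * i) + t ≡ t - (a * i) * s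
      rearrange = solve 4 (λ a s i t → a :* (:- s :* i) :+ t := t :- (a :* i) :* s) refl

    eliminate-pivot : ∀ i → eliminate e i ≡ 0ℚ
    eliminate-pivot i = begin
      e (suc i) - (e zero * 1/ e zero) * e (suc i) ≡⟨ cong (λ c → e (suc i) - c * e (suc i)) (*-inverseʳ (e zero)) ⟩
      e (suc i) - 1ℚ * e (suc i)                   ≡⟨ cancel (e (suc i)) ⟩
      0ℚ                                           ∎
      where
      open ≡-Reasoning
      cancel : ∀ a → a - 1ℚ * a ≡ 0ℚ
      cancel = solve 1 (λ a → a :- con 1ℚ :* a := con 0ℚ) refl

    dot-pivot-extend : ∀ y → dot e (extend y) ≡ 0ℚ
    dot-pivot-extend y = begin
      dot e (extend y)              ≡⟨ dot-extend e y ⟩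
      dot (eliminate e) y           ≡⟨ sumFin-cong (λ i → trans (cong (_* y i) (eliminate-pivot i)) (*-zeroˡ (y i))) ⟩
      sumFin {u} (λ _ → 0ℚ)         ≡⟨ sumFin-zero u ⟩
      0ℚ                            ∎
      where open ≡-Reasoning

  nonzero-solution : ∀ u (E : List (Fin u → ℚ)) → length E ℕ.< u →
    ∃[ x ] (∃[ i ] x i ≢ 0ℚ) × All (λ e → dot e x ≡ 0ℚ) E
  nonzero-solution (ℕ.suc u) E |E|<1+u with all? (λ e → e zero ≟ 0ℚ) E
  ... | yes E₀≡0 =
    unit zero , (zero , 1≢0 ∘ trans (sym (unit-same {ℕ.suc u} zero))) ,
    All.map (λ {e} → trans (dot-unit e zero)) E₀≡0
  ... | no  ¬E₀≡0 =
    let y , (i , yᵢ≢0) , y-solves = nonzero-solution u (map eliminate E′) |E′|<u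
    in extend y , (suc i , yᵢ≢0) ,
       ─⁻ pivot (dot-pivot-extend y) (All.map (λ {f} → trans (dot-extend f y)) (map⁻ y-solves))
    where
    pivot : Any (λ e → e zero ≢ 0ℚ) E
    pivot = ¬All⇒Any¬ (λ e → e zero ≟ 0ℚ) E ¬E₀≡0
    open Pivot (Any.lookup pivot) (lookup-result pivot)
    E′ : List (Fin (ℕ.suc u) → ℚ)
    E′ = E Any.─ pivot
    |E′|<u : length (map eliminate E′) ℕ.< u
    |E′|<u = subst (ℕ._< u) (sym (length-map eliminate E′))
      (ℕ.≤-pred (subst (ℕ._< ℕ.suc u) (length-removeAt′ E (Any.index pivot)) |E|<1+u))

module Tensors where

  open import Data.Fin using (Fin; remQuot; combine)
  open import Data.Fin.Properties using (remQuot-combine; combine-remQuot)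
  open import Data.List using (List; []; _∷_; map; allFin; length)
  open import Data.List.Properties using (length-map; length-tabulate)
  open import Data.List.Membership.Propositional using (_∈_)
  open import Data.List.Membership.Propositional.Properties using (∈-allFin; ∈-map⁺)
  open import Data.List.Relation.Unary.All as All using (All; []; _∷_)
  open import Data.Nat as ℕ using (ℕ)
  open import Data.Product using (∃-syntax; _×_; _,_; proj₁; proj₂; map₂; uncurry)
  open import Data.Rational
  open import Data.Rational.Properties
  open import Data.Rational.Solver
  open import Data.Sum using (inj₁; inj₂)
  open import Function using (_∘_)
  open import Relation.Binary.PropositionalEquality
  open import Relation.Nullary using (yes; no)
  open import Relation.Nullary.Decidable using (toWitness)
  open +-*-Solver
  open import Algebra.Properties.Group +-0-group using (x∙y⁻¹≈ε⇒x≈y)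
  open LinearAlgebra

  Cell : ℕ → Set
  Cell n = Fin n × Fin n × Fin n

  at : ∀ {n} → Tensor n → Cell n → ℚ
  at A (i , j , k) = A i j k

  cube : ∀ n → Fin (n ℕ.* (n ℕ.* n)) → Cell n
  cube n b = map₂ (remQuot {n} n) (remQuot {n} (n ℕ.* n) b)

  remQuot-injective : ∀ {m} n {b b′ : Fin (m ℕ.* n)} → remQuot {m} n b ≡ remQuot n b′ → b ≡ b′
  remQuot-injective {m} n {b} {b′} eq =
    trans (sym (combine-remQuot {m} n b)) (trans (cong (uncurry combine) eq) (combine-remQuot {m} n b′))

  cube-injective : ∀ n {b b′} → cube n b ≡ cube n b′ → b ≡ b′
  cube-injective n eq =
    remQuot-injective {n} (n ℕ.* n) (cong₂ _,_ (cong proj₁ eq) (remQuot-injective {n} n (cong proj₂ eq)))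

  cube-combine : ∀ {n} (i j k : Fin n) → cube n (combine i (combine j k)) ≡ (i , j , k)
  cube-combine {n} i j k = begin
    cube n (combine i (combine j k))  ≡⟨ cong (map₂ (remQuot {n} n)) (remQuot-combine i (combine j k)) ⟩
    (i , remQuot {n} n (combine j k)) ≡⟨ cong (i ,_) (remQuot-combine j k) ⟩
    (i , j , k)                       ∎
    where open ≡-Reasoning

  cells : ∀ n → List (Cell n)
  cells n = map (cube n) (allFin (n ℕ.* (n ℕ.* n)))

  ∈-cells : ∀ {n} (c : Cell n) → c ∈ cells n
  ∈-cells {n} (i , j , k) =
    subst (_∈ cells n) (cube-combine i j k) (∈-map⁺ (cube n) (∈-allFin (combine i (combine j k))))

  length-cells : ∀ n → length (cells n) ≡ n ℕ.* (n ℕ.* n)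
  length-cells n = trans (length-map (cube n) (allFin _)) (length-tabulate {n = n ℕ.* (n ℕ.* n)} (λ b → b))

  record AllLines {n} (P : (Fin n → ℚ) → Set) (A : Tensor n) : Set where
    constructor lines
    field
      lines₁ : ∀ j k → P (λ i → A i j k)
      lines₂ : ∀ i k → P (λ j → A i j k)
      lines₃ : ∀ i j → P (λ k → A i j k)

  AllLines-map : ∀ {n} {P Q : (Fin n → ℚ) → Set} (φ : ℚ → ℚ) {A : Tensor n} →
    (∀ {f} → P f → Q (φ ∘ f)) → AllLines P A → AllLines Q (λ i j k → φ (A i j k))
  AllLines-map φ h (lines p₁ p₂ p₃) = lines (λ j k → h (p₁ j k)) (λ i k → h (p₂ i k)) (λ i j → h (p₃ i j))

  AllLines-zipWith : ∀ {n} {P Q R : (Fin n → ℚ) → Set} (_⊕_ : ℚ → ℚ → ℚ) {A B : Tensor n} →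
    (∀ {f g} → P f → Q g → R (λ i → f i ⊕ g i)) → AllLines P A → AllLines Q B →
    AllLines R (λ i j k → A i j k ⊕ B i j k)
  AllLines-zipWith _⊕_ h (lines p₁ p₂ p₃) (lines q₁ q₂ q₃) =
    lines (λ j k → h (p₁ j k) (q₁ j k)) (λ i k → h (p₂ i k) (q₂ i k)) (λ i j → h (p₃ i j) (q₃ i j))

  ZeroLineSums : ∀ {n} → Tensor n → Set
  ZeroLineSums = AllLines (λ f → sumFin f ≡ 0ℚ)

  UnitLineSums : ∀ {n} → Tensor n → Set
  UnitLineSums = AllLines (λ f → sumFin f ≡ 1ℚ)

  Stochastic⇒UnitLineSums : ∀ {n} {A : Tensor n} → Stochastic A → UnitLineSums A
  Stochastic⇒UnitLineSums (_ , s₁ , s₂ , s₃) = lines s₁ s₂ s₃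

  ZeroLineSums-*ˡ : ∀ {n} c {D : Tensor n} → ZeroLineSums D → ZeroLineSums (λ i j k → c * D i j k)
  ZeroLineSums-*ˡ c = AllLines-map (c *_) (λ {f} f≡0 → trans (sumFin-*ˡ c f) (trans (cong (c *_) f≡0) (*-zeroʳ c)))

  ZeroLineSums-− : ∀ {n} {A B : Tensor n} → Stochastic A → Stochastic B → ZeroLineSums (λ i j k → A i j k - B i j k)
  ZeroLineSums-− A-stoch B-stoch =
    AllLines-zipWith _-_ (λ {f} {g} f≡1 g≡1 → trans (sumFin-− f g) (cong₂ _-_ f≡1 g≡1))
      (Stochastic⇒UnitLineSums A-stoch) (Stochastic⇒UnitLineSums B-stoch)

  ZeroLineSums-dot : ∀ {m n} (T : Fin m → Tensor n) (x : Fin m → ℚ) → (∀ b → ZeroLineSums (T b)) →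
    ZeroLineSums (λ i j k → dot (λ b → T b i j k) x)
  ZeroLineSums-dot T x T-lines = lines
    (λ j k → sumFin-dot-zero (λ b i → T b i j k) x (λ b → AllLines.lines₁ (T-lines b) j k))
    (λ i k → sumFin-dot-zero (λ b j → T b i j k) x (λ b → AllLines.lines₂ (T-lines b) i k))
    (λ i j → sumFin-dot-zero (λ b k → T b i j k) x (λ b → AllLines.lines₃ (T-lines b) i j))

  Stochastic-+ : ∀ {n} {A E : Tensor n} → Stochastic A → ZeroLineSums E → (∀ i j k → 0ℚ ≤ A i j k + E i j k) →
    Stochastic (λ i j k → A i j k + E i j k)
  Stochastic-+ A-stoch E-lines 0≤A+E = 0≤A+E , s₁ , s₂ , s₃
    where
    open AllLines (AllLines-zipWith {R = λ f → sumFin f ≡ 1ℚ} _+_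
      (λ {f} {g} f≡1 g≡0 → trans (sumFin-+ f g) (cong₂ _+_ f≡1 g≡0)) (Stochastic⇒UnitLineSums A-stoch) E-lines)
      renaming (lines₁ to s₁; lines₂ to s₂; lines₃ to s₃)

  p≤∣p∣ : ∀ p → p ≤ ∣ p ∣
  p≤∣p∣ p with ≤-total 0ℚ p
  ... | inj₁ 0≤p = ≤-reflexive (sym (0≤p⇒∣p∣≡p 0≤p))
  ... | inj₂ p≤0 = ≤-trans p≤0 (0≤∣p∣ p)

  -p≤∣p∣ : ∀ p → - p ≤ ∣ p ∣
  -p≤∣p∣ p = subst (- p ≤_) (∣-p∣≡∣p∣ p) (p≤∣p∣ (- p))

  ∣e∣≤a⇒0≤a±e : ∀ {a e} → ∣ e ∣ ≤ a → 0ℚ ≤ a + e × 0ℚ ≤ a + - 1ℚ * e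
  ∣e∣≤a⇒0≤a±e {a} {e} ∣e∣≤a = 0≤a+x (-p≤∣p∣ e) , 0≤a+x (subst (_≤ ∣ e ∣) (e≡-[-1*e] e) (p≤∣p∣ e))
    where
    e≡-[-1*e] : ∀ e → e ≡ - (- 1ℚ * e)
    e≡-[-1*e] = solve 1 (λ e → e := :- (:- con 1ℚ :* e)) refl
    0≤a+x : ∀ {x} → - x ≤ ∣ e ∣ → 0ℚ ≤ a + x
    0≤a+x {x} -x≤∣e∣ = begin
      0ℚ      ≡⟨ +-inverseˡ x ⟨
      - x + x ≤⟨ +-monoˡ-≤ x (≤-trans -x≤∣e∣ ∣e∣≤a) ⟩
      a + x   ∎
      where open ≤-Reasoning

  perturbation-room : ∀ {a d} → 0ℚ ≤ a → (a ≡ 0ℚ → d ≡ 0ℚ) → ∃[ ε ] 0ℚ < ε × ε * ∣ d ∣ ≤ a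
  perturbation-room {a} {d} 0≤a a≡0⇒d≡0 with d ≟ 0ℚ
  ... | yes refl = 1ℚ , positive⁻¹ 1ℚ , 0≤a
  ... | no  d≢0  =
    a ÷ ∣ d ∣ , positive⁻¹ (a ÷ ∣ d ∣) {{pos*pos⇒pos a (1/ ∣ d ∣) {{1/pos⇒pos ∣ d ∣}}}} ,
    ≤-reflexive a÷∣d∣*∣d∣≡a
    where
    instance
      ∣d∣-pos : Positive ∣ d ∣
      ∣d∣-pos = nonNeg∧nonZero⇒pos ∣ d ∣ {{∣-∣-nonNeg d}} {{≢-nonZero (d≢0 ∘ ∣p∣≡0⇒p≡0 d)}}
      ∣d∣-nonZero : NonZero ∣ d ∣
      ∣d∣-nonZero = pos⇒nonZero ∣ d ∣
      a-pos : Positive a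
      a-pos = nonNeg∧nonZero⇒pos a {{nonNegative 0≤a}} {{≢-nonZero (d≢0 ∘ a≡0⇒d≡0)}}
    a÷∣d∣*∣d∣≡a : a ÷ ∣ d ∣ * ∣ d ∣ ≡ a
    a÷∣d∣*∣d∣≡a = trans (*-assoc a (1/ ∣ d ∣) ∣ d ∣) (trans (cong (a *_) (*-inverseˡ ∣ d ∣)) (*-identityʳ a))

  common-positive-bound : ∀ {A : Set} (P : A → ℚ → Set) →
    (∀ {x δ ε} → 0ℚ < δ → δ ≤ ε → P x ε → P x δ) →
    ∀ xs → All (λ x → ∃[ ε ] 0ℚ < ε × P x ε) xs → ∃[ ε ] 0ℚ < ε × All (λ x → P x ε) xs
  common-positive-bound P shrink []       []                      = 1ℚ , positive⁻¹ 1ℚ , []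
  common-positive-bound P shrink (x ∷ xs) ((ε₁ , 0<ε₁ , p₁) ∷ ws) with common-positive-bound P shrink xs ws
  ... | ε₂ , 0<ε₂ , ps with ≤-total ε₁ ε₂
  ...   | inj₁ ε₁≤ε₂ = ε₁ , 0<ε₁ , p₁ ∷ All.map (shrink 0<ε₁ ε₁≤ε₂) ps
  ...   | inj₂ ε₂≤ε₁ = ε₂ , 0<ε₂ , shrink 0<ε₂ ε₂≤ε₁ p₁ ∷ ps

  vertex-no-perturbation : ∀ {n} {A E : Tensor n} → IsVertex A → ZeroLineSums E →
    (∀ i j k → ∣ E i j k ∣ ≤ A i j k) → ∀ i j k → E i j k ≡ 0ℚ
  vertex-no-perturbation {A = A} {E} (A-stoch , A-extreme) E-lines ∣E∣≤A i j k = begin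
    E i j k                       ≡⟨ e≡[a+e]-a (A i j k) (E i j k) ⟩
    (A i j k + E i j k) - A i j k ≡⟨ cong (_- A i j k) (proj₁ A₊≋A∧A₋≋A i j k) ⟩
    A i j k - A i j k             ≡⟨ +-inverseʳ (A i j k) ⟩
    0ℚ                            ∎
    where
    open ≡-Reasoning
    A₊ A₋ : Tensor _
    A₊ i j k = A i j k + E i j k
    A₋ i j k = A i j k + - 1ℚ * E i j k
    A₊-stoch : Stochastic A₊
    A₊-stoch = Stochastic-+ A-stoch E-lines (λ i j k → proj₁ (∣e∣≤a⇒0≤a±e (∣E∣≤A i j k)))
    A₋-stoch : Stochastic A₋
    A₋-stoch = Stochastic-+ A-stoch (ZeroLineSums-*ˡ (- 1ℚ) E-lines)
      (λ i j k → proj₂ (∣e∣≤a⇒0≤a±e (∣E∣≤A i j k)))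
    midpoint : ∀ i j k → A i j k ≡ ½ * A₊ i j k + (1ℚ - ½) * A₋ i j k
    midpoint i j k = mid (A i j k) (E i j k)
      where
      mid : ∀ a e → a ≡ ½ * (a + e) + (1ℚ - ½) * (a + - 1ℚ * e)
      mid = solve 2 (λ a e → a := con ½ :* (a :+ e) :+ (con 1ℚ :- con ½) :* (a :+ :- con 1ℚ :* e)) refl
    A₊≋A∧A₋≋A : (A₊ ≋ A) × (A₋ ≋ A)
    A₊≋A∧A₋≋A = A-extreme A₊ A₋ ½ (positive⁻¹ ½) (toWitness {a? = ½ <? 1ℚ} _) A₊-stoch A₋-stoch midpoint
    e≡[a+e]-a : ∀ a e → e ≡ (a + e) - a
    e≡[a+e]-a = solve 2 (λ a e → e := (a :+ e) :- a) refl

  vertex-rigid : ∀ {n} {A D : Tensor n} → IsVertex A → ZeroLineSums D →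
    (∀ i j k → A i j k ≡ 0ℚ → D i j k ≡ 0ℚ) → ∀ i j k → D i j k ≡ 0ℚ
  vertex-rigid {n} {A} {D} A-vertex D-lines A≡0⇒D≡0 i j k = begin
    D i j k               ≡⟨ 1/ε*[ε*d]≡d (D i j k) ⟨
    1/ ε * (ε * D i j k)  ≡⟨ cong (1/ ε *_) (vertex-no-perturbation A-vertex εD-lines ∣εD∣≤A i j k) ⟩
    1/ ε * 0ℚ             ≡⟨ *-zeroʳ (1/ ε) ⟩
    0ℚ                    ∎
    where
    open ≡-Reasoning
    Room : Cell n → ℚ → Set
    Room c ε = ε * ∣ at D c ∣ ≤ at A c
    shrink : ∀ {c δ ε} → 0ℚ < δ → δ ≤ ε → Room c ε → Room c δ
    shrink {c} _ δ≤ε = ≤-trans (*-monoʳ-≤-nonNeg ∣ at D c ∣ {{∣-∣-nonNeg (at D c)}} δ≤ε)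
    bound : ∃[ ε ] 0ℚ < ε × All (λ c → Room c ε) (cells n)
    bound = common-positive-bound Room shrink (cells n)
      (All.tabulate (λ {(i , j , k)} _ → perturbation-room (proj₁ (proj₁ A-vertex) i j k) (A≡0⇒D≡0 i j k)))
    ε : ℚ
    ε = proj₁ bound
    0<ε : 0ℚ < ε
    0<ε = proj₁ (proj₂ bound)
    εD-lines : ZeroLineSums (λ i j k → ε * D i j k)
    εD-lines = ZeroLineSums-*ˡ ε D-lines
    instance
      ε-nonZero : NonZero ε
      ε-nonZero = pos⇒nonZero ε {{positive 0<ε}}
    ∣εD∣≤A : ∀ i j k → ∣ ε * D i j k ∣ ≤ A i j k
    ∣εD∣≤A i j k =
      subst (_≤ A i j k) (sym ∣εd∣≡ε∣d∣) (All.lookup (proj₂ (proj₂ bound)) (∈-cells (i , j , k)))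
      where
      ∣εd∣≡ε∣d∣ : ∣ ε * D i j k ∣ ≡ ε * ∣ D i j k ∣
      ∣εd∣≡ε∣d∣ = trans (∣p*q∣≡∣p∣*∣q∣ ε (D i j k)) (cong (_* ∣ D i j k ∣) (0≤p⇒∣p∣≡p (<⇒≤ 0<ε)))
    1/ε*[ε*d]≡d : ∀ d → 1/ ε * (ε * d) ≡ d
    1/ε*[ε*d]≡d d = trans (sym (*-assoc (1/ ε) ε d)) (trans (cong (_* d) (*-inverseˡ ε)) (*-identityˡ d))

  vertex-determined-by-zeros : ∀ {n} {A B : Tensor n} → IsVertex A → Stochastic B →
    (∀ i j k → A i j k ≡ 0ℚ → B i j k ≡ 0ℚ) → A ≋ B
  vertex-determined-by-zeros {A = A} {B} A-vertex B-stoch A≡0⇒B≡0 i j k =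
    x∙y⁻¹≈ε⇒x≈y (A i j k) (B i j k)
      (vertex-rigid A-vertex (ZeroLineSums-− (proj₁ A-vertex) B-stoch) A≡0⇒A-B≡0 i j k)
    where
    A≡0⇒A-B≡0 : ∀ i j k → A i j k ≡ 0ℚ → A i j k - B i j k ≡ 0ℚ
    A≡0⇒A-B≡0 i j k A≡0 = cong₂ _-_ A≡0 (A≡0⇒B≡0 i j k A≡0)

module Vertices where

  open import Data.Bool using (Bool; true)
  open import Data.Fin as F using (Fin; suc; inject₁; fromℕ)
  open import Data.Fin.Properties using (inject₁-injective; fromℕ≢inject₁)
  open import Data.List using (List; map; filter; length)
  open import Data.List.Properties using (length-map)
  open import Data.List.Membership.Propositional using (_∈_)
  open import Data.List.Membership.Propositional.Properties using (∈-map⁻; ∈-filter⁺)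
  open import Data.List.Relation.Binary.Subset.Propositional using (_⊆_)
  open import Data.List.Relation.Unary.All as All using (All; []; _∷_)
  open import Data.List.Relation.Unary.All.Properties using (map⁻)
  open import Data.List.Relation.Unary.AllPairs using (AllPairs; []; _∷_)
  import Data.List.Relation.Unary.AllPairs.Properties as AllPairs
  open import Data.List.Relation.Unary.Unique.Propositional using (Unique)
  open import Data.Nat as ℕ using (suc)
  import Data.Nat.Properties as ℕ
  open import Data.Nat.Combinatorics using (_C_)
  open import Data.Nat.Tactic.RingSolver using (solve-∀)
  open import Data.Product using (_,_; proj₁)
  open import Data.Rational
  open import Data.Rational.Properties
  open import Data.Rational.Solver
  open import Function using (_∘_; case_of_)
  open import Relation.Binary.PropositionalEquality
  open import Relation.Nullary using (yes; no; does; proof; contradiction)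
  open import Relation.Nullary.Decidable using (dec-true)
  open import Relation.Nullary.Reflects using (Reflects; invert)
  open +-*-Solver
  open Binomial using (maxSupport)
  open Counting
  open LinearAlgebra
  open Tensors

  unit-diff : ∀ {k} → Fin k → Fin (suc k) → ℚ
  unit-diff {k} a i = unit (inject₁ a) i - unit (fromℕ k) i

  sumFin-unit-diff : ∀ {k} (a : Fin k) → sumFin (unit-diff a) ≡ 0ℚ
  sumFin-unit-diff {k} a =
    trans (sumFin-− (unit (inject₁ a)) (unit (fromℕ k))) (cong₂ _-_ (sumFin-unit (inject₁ a)) (sumFin-unit (fromℕ k)))

  unit-inject₁ : ∀ {k} (a a′ : Fin k) → unit (inject₁ a) (inject₁ a′) ≡ unit a a′
  unit-inject₁ a a′ = case a F.≟ a′ of λ where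
    (yes refl) → trans (unit-same (inject₁ a)) (sym (unit-same a))
    (no a≢a′)  → trans (unit-≢ (a≢a′ ∘ inject₁-injective)) (sym (unit-≢ a≢a′))

  unit-diff-inject₁ : ∀ {k} (a a′ : Fin k) → unit-diff a (inject₁ a′) ≡ unit a a′
  unit-diff-inject₁ {k} a a′ =
    trans (cong₂ _-_ (unit-inject₁ a a′) (unit-≢ (fromℕ≢inject₁ {k} {a′}))) (+-identityʳ (unit a a′))

  basis : ∀ {k} → Cell k → Tensor (suc k)
  basis (a₁ , a₂ , a₃) i j l = unit-diff a₁ i * unit-diff a₂ j * unit-diff a₃ l

  basis-lines : ∀ {k} (a : Cell k) → ZeroLineSums (basis a)
  basis-lines (a₁ , a₂ , a₃) = lines
    (λ j l → sumFin-scaled-zero (unit-diff a₂ j * unit-diff a₃ l) (sumFin-unit-diff a₁)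
               (λ i → move₁ (unit-diff a₁ i) (unit-diff a₂ j) (unit-diff a₃ l)))
    (λ i l → sumFin-scaled-zero (unit-diff a₁ i * unit-diff a₃ l) (sumFin-unit-diff a₂)
               (λ j → move₂ (unit-diff a₁ i) (unit-diff a₂ j) (unit-diff a₃ l)))
    (λ i j → sumFin-scaled-zero {f = unit-diff a₃} (unit-diff a₁ i * unit-diff a₂ j) (sumFin-unit-diff a₃)
               (λ l → refl))
    where
    move₁ : ∀ u v w → u * v * w ≡ (v * w) * u
    move₁ = solve 3 (λ u v w → u :* v :* w := (v :* w) :* u) refl
    move₂ : ∀ u v w → u * v * w ≡ (u * w) * v
    move₂ = solve 3 (λ u v w → u :* v :* w := (u :* w) :* v) refl

  corner : ∀ {k} → Cell k → Cell (suc k)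
  corner (a₁ , a₂ , a₃) = inject₁ a₁ , inject₁ a₂ , inject₁ a₃

  basis-corner : ∀ {k} (a₁ a₂ a₃ a₁′ a₂′ a₃′ : Fin k) →
    at (basis (a₁ , a₂ , a₃)) (corner (a₁′ , a₂′ , a₃′)) ≡ unit a₁ a₁′ * unit a₂ a₂′ * unit a₃ a₃′
  basis-corner a₁ a₂ a₃ a₁′ a₂′ a₃′ =
    cong₂ _*_ (cong₂ _*_ (unit-diff-inject₁ a₁ a₁′) (unit-diff-inject₁ a₂ a₂′)) (unit-diff-inject₁ a₃ a₃′)

  basis-corner-same : ∀ {k} (a : Cell k) → at (basis a) (corner a) ≡ 1ℚ
  basis-corner-same (a₁ , a₂ , a₃) = trans (basis-corner a₁ a₂ a₃ a₁ a₂ a₃)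
    (cong₂ _*_ (cong₂ _*_ (unit-same a₁) (unit-same a₂)) (unit-same a₃))

  basis-corner-≢ : ∀ {k} {a a′ : Cell k} → a ≢ a′ → at (basis a) (corner a′) ≡ 0ℚ
  basis-corner-≢ {a = a₁ , a₂ , a₃} {a₁′ , a₂′ , a₃′} a≢a′ =
    trans (basis-corner a₁ a₂ a₃ a₁′ a₂′ a₃′)
      (case ((a₁ F.≟ a₁′) , (a₂ F.≟ a₂′) , (a₃ F.≟ a₃′)) of λ where
      (yes e₁ , yes e₂ , yes e₃)  → contradiction (cong₂ _,_ e₁ (cong₂ _,_ e₂ e₃)) a≢a′
      (no a₁≢a₁′ , _ , _)         → trans (cong (λ t → t * u₂ * u₃) (unit-≢ a₁≢a₁′))
                                          (trans (cong (_* u₃) (*-zeroˡ u₂)) (*-zeroˡ u₃))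
      (yes _ , no a₂≢a₂′ , _)     → trans (cong (λ t → u₁ * t * u₃) (unit-≢ a₂≢a₂′))
                                          (trans (cong (_* u₃) (*-zeroʳ u₁)) (*-zeroˡ u₃))
      (yes _ , yes _ , no a₃≢a₃′) → trans (cong (u₁ * u₂ *_) (unit-≢ a₃≢a₃′)) (*-zeroʳ (u₁ * u₂)))
    where
    u₁ = unit a₁ a₁′
    u₂ = unit a₂ a₂′
    u₃ = unit a₃ a₃′

  basis-combination : ∀ {k} → (Fin (k ℕ.* (k ℕ.* k)) → ℚ) → Tensor (suc k)
  basis-combination {k} x i j l = dot (λ b → basis (cube k b) i j l) x

  basis-combination-lines : ∀ {k} (x : Fin (k ℕ.* (k ℕ.* k)) → ℚ) → ZeroLineSums (basis-combination x)
  basis-combination-lines {k} x = ZeroLineSums-dot (basis ∘ cube k) x (basis-lines ∘ cube k)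

  basis-combination-corner : ∀ {k} (x : Fin (k ℕ.* (k ℕ.* k)) → ℚ) b →
    at (basis-combination x) (corner (cube k b)) ≡ x b
  basis-combination-corner {k} x b = begin
    dot (λ b′ → at (basis (cube k b′)) (corner (cube k b))) x ≡⟨ sumFin-single _ b off-b ⟩
    at (basis (cube k b)) (corner (cube k b)) * x b           ≡⟨ cong (_* x b) (basis-corner-same (cube k b)) ⟩
    1ℚ * x b                                                  ≡⟨ *-identityˡ (x b) ⟩
    x b                                                       ∎
    where
    open ≡-Reasoning
    off-b : ∀ b′ → b′ ≢ b → at (basis (cube k b′)) (corner (cube k b)) * x b′ ≡ 0ℚ
    off-b b′ b′≢b = trans (cong (_* x b′) (basis-corner-≢ (b′≢b ∘ cube-injective k))) (*-zeroˡ (x b′))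

  zeroCells : ∀ {n} → Tensor n → List (Cell n)
  zeroCells {n} A = filter (λ c → at A c ≟ 0ℚ) (cells n)

  -- Otherwise the system "basis-combination x vanishes at every zero of A" has a solution
  -- x ≠ 0; by rigidity basis-combination x is then zero everywhere, yet its value at
  -- corner (cube k b) is x b.
  vertex-zeros : ∀ {k} {A : Tensor (suc k)} → IsVertex A → k ℕ.* (k ℕ.* k) ℕ.≤ length (zeroCells A)
  vertex-zeros {k} {A} A-vertex with k ℕ.* (k ℕ.* k) ℕ.≤? length (zeroCells A)
  ... | yes k³≤∣Z∣ = k³≤∣Z∣
  ... | no  k³≰∣Z∣ =
    let x , (b , xᵦ≢0) , x-solves = nonzero-solution _ equations |equations|<k³
    in contradiction (trans (sym (basis-combination-corner {k} x b)) (vanishes-everywhere x x-solves (corner (cube k b))))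
         xᵦ≢0
    where
    equations : List (Fin (k ℕ.* (k ℕ.* k)) → ℚ)
    equations = map (λ c b → at (basis (cube k b)) c) (zeroCells A)
    |equations|<k³ : length equations ℕ.< k ℕ.* (k ℕ.* k)
    |equations|<k³ = subst (ℕ._< _) (sym (length-map _ (zeroCells A))) (ℕ.≰⇒> k³≰∣Z∣)
    vanishes-everywhere : ∀ x → All (λ e → dot e x ≡ 0ℚ) equations → ∀ c → at (basis-combination x) c ≡ 0ℚ
    vanishes-everywhere x x-solves (i , j , l) =
      vertex-rigid A-vertex (basis-combination-lines x) vanishes-on-zeros i j l
      where
      vanishes-on-zeros : ∀ i j l → A i j l ≡ 0ℚ → basis-combination x i j l ≡ 0ℚ
      vanishes-on-zeros i j l A≡0 =
        All.lookup (map⁻ x-solves) (∈-filter⁺ (λ c → at A c ≟ 0ℚ) (∈-cells (i , j , l)) A≡0)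

  zeroPattern : ∀ {n} → Tensor n → List Bool
  zeroPattern {n} A = map (λ c → does (at A c ≟ 0ℚ)) (cells n)

  length-zeroPattern : ∀ {n} (A : Tensor n) → length (zeroPattern A) ≡ n ℕ.^ 3
  length-zeroPattern {n} A =
    trans (length-map _ (cells n)) (trans (length-cells n) (cong (λ t → n ℕ.* (n ℕ.* t)) (sym (ℕ.*-identityʳ n))))

  vertex-sparse : ∀ {k} {A : Tensor (suc k)} → IsVertex A → falses (zeroPattern A) ℕ.≤ maxSupport k
  vertex-sparse {k} {A} A-vertex = ℕ.+-cancelˡ-≤ (k ℕ.* (k ℕ.* k)) _ _ (begin
    k ℕ.* (k ℕ.* k) ℕ.+ falses (zeroPattern A)      ≤⟨ ℕ.+-monoˡ-≤ (falses (zeroPattern A)) (vertex-zeros A-vertex) ⟩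
    length (zeroCells A) ℕ.+ falses (zeroPattern A) ≡⟨ ℕ.+-comm (length (zeroCells A)) _ ⟩
    falses (zeroPattern A) ℕ.+ length (zeroCells A) ≡⟨ falses-map-does+length-filter (λ c → at A c ≟ 0ℚ) (cells (suc k)) ⟩
    length (cells (suc k))                          ≡⟨ length-cells (suc k) ⟩
    suc k ℕ.* (suc k ℕ.* suc k)                     ≡⟨ [1+k]³≡k³+maxSupport k ⟩
    k ℕ.* (k ℕ.* k) ℕ.+ maxSupport k                ∎)
    where
    open ℕ.≤-Reasoning
    [1+k]³≡k³+maxSupport : ∀ k → (1 ℕ.+ k) ℕ.* ((1 ℕ.+ k) ℕ.* (1 ℕ.+ k))
                                   ≡ k ℕ.* (k ℕ.* k) ℕ.+ (3 ℕ.* (k ℕ.* k) ℕ.+ 3 ℕ.* k ℕ.+ 1)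
    [1+k]³≡k³+maxSupport = solve-∀

  zeroPattern-injective : ∀ {n} {A B : Tensor n} → IsVertex A → Stochastic B → zeroPattern A ≡ zeroPattern B → A ≋ B
  zeroPattern-injective {A = A} {B} A-vertex B-stoch same = vertex-determined-by-zeros A-vertex B-stoch A≡0⇒B≡0
    where
    A≡0⇒B≡0 : ∀ i j k → A i j k ≡ 0ℚ → B i j k ≡ 0ℚ
    A≡0⇒B≡0 i j k A≡0 = invert (subst (Reflects _) B-flagged (proof (B i j k ≟ 0ℚ)))
      where
      B-flagged : does (B i j k ≟ 0ℚ) ≡ true
      B-flagged = trans (sym (map-≡⇒∈-≗ same (∈-cells (i , j , k)))) (dec-true (A i j k ≟ 0ℚ) A≡0)

  zeroPatterns-unique : ∀ {n} {L : List (Tensor n)} → All IsVertex L → AllPairs Distinct L → Unique (map zeroPattern L)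
  zeroPatterns-unique vs ds = AllPairs.map⁺ (distinct-patterns vs ds)
    where
    distinct-patterns : ∀ {L} → All IsVertex L → AllPairs Distinct L →
      AllPairs (λ A B → zeroPattern A ≢ zeroPattern B) L
    distinct-patterns []              []          = []
    distinct-patterns (A-vertex ∷ vs) (A≉ ∷ ds) =
      All.zipWith (λ (B-vertex , A≉B) → A≉B ∘ zeroPattern-injective A-vertex (proj₁ B-vertex)) (vs , A≉)
        ∷ distinct-patterns vs ds

  vertex-count : ∀ k (L : List (Tensor (suc k))) → AllPairs Distinct L → All IsVertex L →
    length L ℕ.≤ (suc k ℕ.^ 3 ℕ.+ maxSupport k) C maxSupport k
  vertex-count k L L-distinct L-vertices = begin
    length L                   ≡⟨ length-map zeroPattern L ⟨
    length (map zeroPattern L) ≤⟨ Unique∧⊆⇒length≤ (zeroPatterns-unique L-vertices L-distinct) patterns⊆sparse ⟩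
    length (sparse N m)        ≤⟨ length-sparse N m ⟩
    (N ℕ.+ m) C m              ∎
    where
    open ℕ.≤-Reasoning
    N = suc k ℕ.^ 3
    m = maxSupport k
    patterns⊆sparse : map zeroPattern L ⊆ sparse N m
    patterns⊆sparse P∈ with ∈-map⁻ zeroPattern P∈
    ... | A , A∈L , refl = subst (λ N → zeroPattern A ∈ sparse N m) (length-zeroPattern A)
      (∈-sparse (zeroPattern A) (vertex-sparse (All.lookup L-vertices A∈L)))

open Binomial using (maxSupport; binomial-estimate)
open Vertices using (vertex-count)

open import Data.Nat using (ℕ; _≤_; _*_; _^_; _∸_)
open import Data.Nat.Combinatorics using (_C_)
open import Data.List using (List; length)
open import Data.List.Relation.Unary.All using (All)
open import Data.List.Relation.Unary.AllPairs using (AllPairs)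
open import Data.Nat using (suc; s≤s; _+_)
open import Data.Nat.Properties using (*-monoʳ-≤; module ≤-Reasoning)

mainTheorem3 : (n : ℕ) → 2 ≤ n → (L : List (Tensor n)) →
    AllPairs Distinct L → All IsVertex L →
    n ^ 3 * length L ≤ p n C (n ^ 3 ∸ 1)
mainTheorem3 (suc k) (s≤s 1≤k) L L-distinct L-vertices = begin
  suc k ^ 3 * length L                                    ≤⟨ *-monoʳ-≤ (suc k ^ 3) (vertex-count k L L-distinct L-vertices) ⟩
  suc k ^ 3 * ((suc k ^ 3 + maxSupport k) C maxSupport k) ≤⟨ binomial-estimate k 1≤k ⟩
  p (suc k) C (suc k ^ 3 ∸ 1)                             ∎
  where open ≤-Reasoning
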